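{- Let $p>2$ be prime. For all $\varepsilon>0$ and all finite bipartite graphs $F=(U\cup V,E)$ (with parts $U,V$ and edge set $E$) the following holds. Let $A\subseteq\mathbb{F}_p^n$, let $\mathcal{L}$ be a linear factor on $\mathbb{F}_p^n$ of complexity $\ell$, and let $d=(d_u)_{u\in U}(d_v)_{v\in V}$ with each $d_u,d_v\in\mathbb{F}_p^\ell$. For $(u,v)\in U\times V$ let $\alpha_{uv}=|A\cap L(d_u+d_v)|/|L(d_u+d_v)|$. Suppose that for each $(u,v)\in U\times V$, $\|1_A-\alpha_{uv}\|_{U^2((d_u,d_v))}\leq\varepsilon$. Then the number of tuples $(x_u)_{u\in U}(y_v)_{v\in V}\in\prod_{u\in U}L(d_u)\times\prod_{v\in V}L(d_v)$ such that $x_u+y_v\in A$ if and only if $uv\in E$ differs in absolute value by at most $\varepsilon|U||V|\prod_{u\in U}|L(d_u)|\prod_{v\in V}|L(d_v)|$ from \[\prod_{u\in U,v\in V:uv\in E}\alpha_{uv}\prod_{u\in U,v\in V:uv\notin E}(1-\alpha_{uv})\prod_{u\in U}|L(d_u)|\prod_{v\in V}|L(d_v)|.\]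
   Context: A linear factor $\mathcal{L}$ on $\mathbb{F}_p^n$ of complexity $\ell$ is a set of linearly independent vectors $r_1,\dots,r_\ell\in\mathbb{F}_p^n$; for $a\in\mathbb{F}_p^\ell$, $L(a)=\{x\in\mathbb{F}_p^n: x^Tr_i=a_i\ \forall i\in[\ell]\}$. For $(a_1,a_2)\in\mathbb{F}_p^\ell\times\mathbb{F}_p^\ell$ and $f:\mathbb{F}_p^n\to\mathbb{C}$, the local $U^2$ semi-norm is given by $\|f\|_{U^2((a_1,a_2))}^4=\mathbb{E}_{x_0,x_1\in L(a_1)}\mathbb{E}_{y_0,y_1\in L(a_2)}\prod_{\varepsilon\in\{0,1\}^2}\mathcal{C}^{|\varepsilon|}f(x_{\varepsilon(1)}+y_{\varepsilon(2)})$, where $|\varepsilon|$ is the number of ones in $\varepsilon$, $\mathcal{C}^k$ is complex conjugation applied $k$ times, and $\mathbb{E}_{x\in X}$ denotes the average over $X$.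
   Formalization: The parameter ε ranges over the positive rationals. -}

module Defs where

open import Data.Bool using (Bool; true; false; _∧_; if_then_else_)
open import Data.Nat as ℕ using (ℕ; zero; suc; NonZero)
open import Data.Nat.DivMod using (_%_; m%n<n)
open import Data.Fin as Fin using (Fin; toℕ; fromℕ<)
open import Data.List as List using (List; []; _∷_; length; allFin; filterᵇ; concatMap; map; foldr)
open import Data.Vec as Vec using (Vec; []; _∷_; zipWith; lookup; tabulate)
open import Data.Vec.Properties using (≡-dec)
import Data.Nat.ListAction as ℕL
open import Data.Integer using (+_)
open import Data.Rational as ℚ using (ℚ; 0ℚ; 1ℚ; _/_)
open import Relation.Nullary using (does)
open import Relation.Binary.PropositionalEquality using (_≡_)

module _ (p : ℕ) .{{_ : NonZero p}} where

  Fp : Set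
  Fp = Fin p

  0F : Fp
  0F = fromℕ< (m%n<n 0 p)

  _+F_ : Fp → Fp → Fp
  a +F b = fromℕ< (m%n<n (toℕ a ℕ.+ toℕ b) p)

  _*F_ : Fp → Fp → Fp
  a *F b = fromℕ< (m%n<n (toℕ a ℕ.* toℕ b) p)

  Vp : ℕ → Set
  Vp n = Vec Fp n

  0V : ∀ {n} → Vp n
  0V = Vec.replicate _ 0F

  _+V_ : ∀ {n} → Vp n → Vp n → Vp n
  _+V_ = zipWith _+F_

  _·V_ : ∀ {n} → Fp → Vp n → Vp n
  c ·V x = Vec.map (c *F_) x

  dot : ∀ {n} → Vp n → Vp n → Fp
  dot x r = Vec.foldr _ _+F_ 0F (zipWith _*F_ x r)

  lincomb : ∀ {ℓ n} → Vp ℓ → Vec (Vp n) ℓ → Vp n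
  lincomb c r = Vec.foldr _ _+V_ 0V (zipWith _·V_ c r)

  -- a linear factor of complexity ℓ on F_p^n:
  -- ℓ linearly independent vectors r_1 .. r_ℓ
  LinearlyIndependent : ∀ {ℓ n} → Vec (Vp n) ℓ → Set
  LinearlyIndependent {ℓ} r = (c : Vp ℓ) → lincomb c r ≡ 0V → c ≡ 0V

  record LinearFactor (n ℓ : ℕ) : Set where
    field
      vecs  : Vec (Vp n) ℓ
      indep : LinearlyIndependent vecs

  allVecs : ∀ {X : Set} → List X → (n : ℕ) → List (Vec X n)
  allVecs xs zero    = [] ∷ []
  allVecs xs (suc n) = concatMap (λ x → map (x ∷_) (allVecs xs n)) xs

  tuples : ∀ {X : Set} {k : ℕ} → Vec (List X) k → List (Vec X k)
  tuples []         = [] ∷ []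
  tuples (xs ∷ xss) = concatMap (λ x → map (x ∷_) (tuples xss)) xs

  allVp : (n : ℕ) → List (Vp n)
  allVp n = allVecs (allFin p) n

  vecEqᵇ : ∀ {n} → Vp n → Vp n → Bool
  vecEqᵇ x y = does (≡-dec Fin._≟_ x y)

  Lset : ∀ {n ℓ} → LinearFactor n ℓ → Vp ℓ → List (Vp n)
  Lset 𝓛 a = filterᵇ (λ x → vecEqᵇ (Vec.map (dot x) (LinearFactor.vecs 𝓛)) a) (allVp _)

ℕtoℚ : ℕ → ℚ
ℕtoℚ m = + m / 1

-- m / k as a rational; (0 when k = 0, which never happens below
-- since the sets L(a) are nonempty for a linear factor)
frac : ℕ → ℕ → ℚ
frac m zero    = 0ℚ
frac m (suc k) = + m / suc k

sumℚ : List ℚ → ℚ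
sumℚ = foldr ℚ._+_ 0ℚ

prodℚ : List ℚ → ℚ
prodℚ = foldr ℚ._*_ 1ℚ

avg : ∀ {X : Set} → List X → (X → ℚ) → ℚ
avg xs g with length xs
... | zero  = 0ℚ
... | suc k = sumℚ (map g xs) ℚ.* (+ 1 / suc k)

indicator : Bool → ℚ
indicator b = if b then 1ℚ else 0ℚ

allᵇ : ∀ {X : Set} → (X → Bool) → List X → Bool
allᵇ q = foldr (λ x b → q x ∧ b) true

module _ (p : ℕ) .{{_ : NonZero p}} {n ℓ : ℕ} (𝓛 : LinearFactor p n ℓ) where

  L : Vp p ℓ → List (Vp p n)
  L = Lset p 𝓛

  density : (Vp p n → Bool) → Vp p ℓ → ℚ
  density A a = frac (length (filterᵇ A (L a))) (length (L a))

  -- ‖f‖^4_{U²((a₁,a₂))} for a real-valued f (complex conjugation is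
  -- the identity on real values)
  U2⁴ : (Vp p n → ℚ) → Vp p ℓ → Vp p ℓ → ℚ
  U2⁴ f a₁ a₂ =
    avg (L a₁) λ x₀ → avg (L a₁) λ x₁ → avg (L a₂) λ y₀ → avg (L a₂) λ y₁ →
      f (_+V_ p x₀ y₀) ℚ.* f (_+V_ p x₀ y₁) ℚ.* f (_+V_ p x₁ y₀) ℚ.* f (_+V_ p x₁ y₁)

  -- the bipartite graph F has parts U = Fin k, V = Fin m, edges E
  module _ {k m : ℕ} (E : Fin k → Fin m → Bool) (A : Vp p n → Bool)
           (dU : Fin k → Vp p ℓ) (dV : Fin m → Vp p ℓ) where

    α : Fin k → Fin m → ℚ
    α u v = density A (_+V_ p (dU u) (dV v))

    goodCount : ℕ
    goodCount = length (filterᵇ good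
      (concatMap (λ xs → map (λ ys → (xs , ys)) (tuples p (tabulate (λ v → L (dV v)))))
                 (tuples p (tabulate (λ u → L (dU u))))))
      where
        open import Data.Product using (_×_; _,_)
        good : Vec (Vp p n) k × Vec (Vp p n) m → Bool
        good (xs , ys) = allᵇ (λ u → allᵇ (λ v →
            does (Data.Bool._≟_ (A (_+V_ p (lookup xs u) (lookup ys v))) (E u v)))
          (allFin m)) (allFin k)
          where import Data.Bool

    sizeProduct : ℕ
    sizeProduct = ℕL.product (map (λ u → length (L (dU u))) (allFin k))
            ℕ.* ℕL.product (map (λ v → length (L (dV v))) (allFin m))

    mainTerm : ℚ
    mainTerm = prodℚ (concatMap (λ u → map (λ v →
                 if E u v then α u v else 1ℚ ℚ.- α u v) (allFin m)) (allFin k))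
               ℚ.* ℕtoℚ sizeProduct

{-# OPTIONS --safe #-}
module Submission where

-- Write the count as a sum, over all tuples (x, y), of ∏_{u,v} g_uv(x_u, y_v), where
-- g_uv ∈ {0, 1} records whether "x_u + y_v ∈ A" agrees with "uv ∈ E"; the main term is the
-- same sum of ∏_{u,v} c_uv with c_uv = α_uv or 1 − α_uv.  Replacing the factors g_uv by the
-- constants c_uv one at a time leaves |U||V| error terms.  In each of them freeze every
-- coordinate except x_u and y_v: the remaining factors depend on only one of x_u, y_v, so the
-- term is a sum ∑_{t,s} a(t) b(s) (g_uv − c_uv)(t, s) with [0,1]-valued a and b, and
-- g_uv − c_uv = ±(1_A − α_uv)(t + s).  By the Gowers–Cauchy–Schwarz inequality such a sum is at
-- most ‖1_A − α_uv‖_{U²((d_u,d_v))} |L(d_u)| |L(d_v)|.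

open import Defs
open import Data.Bool as Bool using (Bool; true; false; if_then_else_)
open import Data.Empty using (⊥-elim)
open import Data.Fin as Fin using (Fin; zero; suc)
import Data.Integer as ℤ
import Data.Integer.Properties as ℤ
open import Data.List as List using (List; []; _∷_; _++_; map; concatMap; length; filterᵇ)
import Data.List.Properties as List
open import Data.List.Relation.Unary.All using (All; []; _∷_)
open import Data.List.Relation.Unary.AllPairs using ([]; _∷_)
open import Data.List.Relation.Unary.Unique.Propositional using (Unique)
import Data.List.Relation.Unary.Unique.Propositional.Properties as Unique
open import Data.Nat as ℕ using (ℕ; zero; suc; NonZero)
import Data.Nat.ListAction as ℕ
open import Data.Nat.Primality using (Prime)
open import Data.Product using (_×_; _,_; proj₂)
open import Data.Rational as ℚ
  using (ℚ; 0ℚ; 1ℚ; ½; toℚᵘ; nonNegative; positive; _+_; _*_; _-_; -_; _≤_; _<_; ∣_∣)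
open import Data.Rational.Properties
open import Data.Rational.Solver using (module +-*-Solver)
import Data.Rational.Unnormalised as ℚᵘ
import Data.Rational.Unnormalised.Properties as ℚᵘ
open import Data.Sum using (inj₁; inj₂)
open import Data.Vec using (Vec; _∷_; tabulate; lookup; _[_]≔_)
open import Data.Vec.Properties using (lookup∘update; lookup∘update′)
open import Function using (_∘_; id)
open import Relation.Nullary using (yes; no; does)
open import Relation.Binary.PropositionalEquality

open +-*-Solver

private
  variable
    A B : Set

-- Rational arithmetic

_∈[0,1] : ℚ → Set
q ∈[0,1] = 0ℚ ≤ q × q ≤ 1ℚ

1∈[0,1] : 1ℚ ∈[0,1]
1∈[0,1] = nonNegative⁻¹ 1ℚ , ≤-refl

*-monoˡ-≤-0≤ : ∀ {r p q} → 0ℚ ≤ r → p ≤ q → r * p ≤ r * q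
*-monoˡ-≤-0≤ {r} 0≤r = *-monoˡ-≤-nonNeg r {{nonNegative 0≤r}}

*-monoʳ-≤-0≤ : ∀ {r p q} → 0ℚ ≤ r → p ≤ q → p * r ≤ q * r
*-monoʳ-≤-0≤ {r} 0≤r = *-monoʳ-≤-nonNeg r {{nonNegative 0≤r}}

0≤* : ∀ {p q} → 0ℚ ≤ p → 0ℚ ≤ q → 0ℚ ≤ p * q
0≤* {p} {q} 0≤p 0≤q = ≤-trans (≤-reflexive (sym (*-zeroˡ q))) (*-monoʳ-≤-0≤ 0≤q 0≤p)

∈[0,1]-* : ∀ {p q} → p ∈[0,1] → q ∈[0,1] → (p * q) ∈[0,1]
∈[0,1]-* {p} (0≤p , p≤1) (0≤q , q≤1) =
  0≤* 0≤p 0≤q , ≤-trans (*-monoˡ-≤-0≤ 0≤p q≤1) (≤-trans (≤-reflexive (*-identityʳ p)) p≤1)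

∈[0,1]⇒1-q∈[0,1] : ∀ {q} → q ∈[0,1] → (1ℚ - q) ∈[0,1]
∈[0,1]⇒1-q∈[0,1] {q} (0≤q , q≤1) =
  ≤-trans (≤-reflexive (sym (+-inverseʳ q))) (+-monoˡ-≤ (- q) q≤1) ,
  ≤-trans (+-monoʳ-≤ 1ℚ (neg-antimono-≤ 0≤q)) (≤-reflexive (+-identityʳ 1ℚ))

∈[0,1]⇒∣q∣≤1 : ∀ {q} → q ∈[0,1] → ∣ q ∣ ≤ 1ℚ
∈[0,1]⇒∣q∣≤1 (0≤q , q≤1) = ≤-trans (≤-reflexive (0≤p⇒∣p∣≡p 0≤q)) q≤1

p*p≡∣p∣*∣p∣ : ∀ p → p * p ≡ ∣ p ∣ * ∣ p ∣
p*p≡∣p∣*∣p∣ p with ∣p∣≡p∨∣p∣≡-p p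
... | inj₁ ∣p∣≡p  = cong₂ _*_ (sym ∣p∣≡p) (sym ∣p∣≡p)
... | inj₂ ∣p∣≡-p =
  trans (solve 1 (λ p → p :* p := (:- p) :* (:- p)) refl p) (cong₂ _*_ (sym ∣p∣≡-p) (sym ∣p∣≡-p))

0≤p*p : ∀ p → 0ℚ ≤ p * p
0≤p*p p = ≤-trans (0≤* (0≤∣p∣ p) (0≤∣p∣ p)) (≤-reflexive (sym (p*p≡∣p∣*∣p∣ p)))

*-self-mono-≤ : ∀ {p q} → 0ℚ ≤ p → p ≤ q → p * p ≤ q * q
*-self-mono-≤ 0≤p p≤q = ≤-trans (*-monoˡ-≤-0≤ 0≤p p≤q) (*-monoʳ-≤-0≤ (≤-trans 0≤p p≤q) p≤q)

*-self-mono-< : ∀ {p q} → 0ℚ ≤ p → p < q → p * p < q * q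
*-self-mono-< {p} {q} 0≤p p<q = ≤-<-trans (*-monoʳ-≤-0≤ 0≤p (<⇒≤ p<q))
  (*-monoʳ-<-pos q {{positive (≤-<-trans 0≤p p<q)}} p<q)

p⁴≤q⁴⇒∣p∣≤q : ∀ {p q} → 0ℚ ≤ q → (p * p) * (p * p) ≤ (q * q) * (q * q) → ∣ p ∣ ≤ q
p⁴≤q⁴⇒∣p∣≤q {p} {q} 0≤q p⁴≤q⁴ with ∣ p ∣ ≤? q
... | yes ∣p∣≤q = ∣p∣≤q
... | no  ∣p∣≰q = ⊥-elim (<-irrefl refl (begin-strict
  (p * p) * (p * p)                  ≤⟨ p⁴≤q⁴ ⟩
  (q * q) * (q * q)                  <⟨ *-self-mono-< (0≤p*p q) (*-self-mono-< 0≤q (≰⇒> ∣p∣≰q)) ⟩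
  (∣ p ∣ * ∣ p ∣) * (∣ p ∣ * ∣ p ∣)  ≡⟨ cong₂ _*_ (p*p≡∣p∣*∣p∣ p) (p*p≡∣p∣*∣p∣ p) ⟨
  (p * p) * (p * p)                  ∎))
  where open ≤-Reasoning

0≤p-q⇒q≤p : ∀ {p q} → 0ℚ ≤ p - q → q ≤ p
0≤p-q⇒q≤p {p} {q} 0≤p-q = begin
  q            ≡⟨ +-identityʳ q ⟨
  q + 0ℚ       ≤⟨ +-monoʳ-≤ q 0≤p-q ⟩
  q + (p - q)  ≡⟨ solve 2 (λ p q → q :+ (p :- q) := p) refl p q ⟩
  p            ∎
  where open ≤-Reasoning

toℚᵘ-ℕtoℚ : ∀ a → toℚᵘ (ℕtoℚ a) ℚᵘ.≃ ℚᵘ.mkℚᵘ (ℤ.+ a) 0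
toℚᵘ-ℕtoℚ a = toℚᵘ-fromℚᵘ (ℚᵘ.mkℚᵘ (ℤ.+ a) 0)

ℕtoℚ-+ : ∀ a b → ℕtoℚ (a ℕ.+ b) ≡ ℕtoℚ a + ℕtoℚ b
ℕtoℚ-+ a b = toℚᵘ-injective (begin
  toℚᵘ (ℕtoℚ (a ℕ.+ b))                        ≈⟨ toℚᵘ-ℕtoℚ (a ℕ.+ b) ⟩
  ℚᵘ.mkℚᵘ (ℤ.+ (a ℕ.+ b)) 0                    ≈⟨ ℚᵘ.*≡* (cong (ℤ._* ℤ.1ℤ) numerators) ⟩
  ℚᵘ.mkℚᵘ (ℤ.+ a) 0 ℚᵘ.+ ℚᵘ.mkℚᵘ (ℤ.+ b) 0     ≈⟨ ℚᵘ.+-cong (toℚᵘ-ℕtoℚ a) (toℚᵘ-ℕtoℚ b) ⟨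
  toℚᵘ (ℕtoℚ a) ℚᵘ.+ toℚᵘ (ℕtoℚ b)             ≈⟨ toℚᵘ-homo-+ (ℕtoℚ a) (ℕtoℚ b) ⟨
  toℚᵘ (ℕtoℚ a + ℕtoℚ b)                       ∎)
  where
  open ℚᵘ.≃-Reasoning
  numerators : ℤ.+ (a ℕ.+ b) ≡ ℤ.+ a ℤ.* ℤ.1ℤ ℤ.+ ℤ.+ b ℤ.* ℤ.1ℤ
  numerators = trans (ℤ.pos-+ a b) (sym (cong₂ ℤ._+_ (ℤ.*-identityʳ (ℤ.+ a)) (ℤ.*-identityʳ (ℤ.+ b))))

ℕtoℚ-* : ∀ a b → ℕtoℚ (a ℕ.* b) ≡ ℕtoℚ a * ℕtoℚ b
ℕtoℚ-* a b = toℚᵘ-injective (begin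
  toℚᵘ (ℕtoℚ (a ℕ.* b))                        ≈⟨ toℚᵘ-ℕtoℚ (a ℕ.* b) ⟩
  ℚᵘ.mkℚᵘ (ℤ.+ (a ℕ.* b)) 0                    ≈⟨ ℚᵘ.*≡* (cong (ℤ._* ℤ.1ℤ) (ℤ.pos-* a b)) ⟩
  ℚᵘ.mkℚᵘ (ℤ.+ a) 0 ℚᵘ.* ℚᵘ.mkℚᵘ (ℤ.+ b) 0     ≈⟨ ℚᵘ.*-cong (toℚᵘ-ℕtoℚ a) (toℚᵘ-ℕtoℚ b) ⟨
  toℚᵘ (ℕtoℚ a) ℚᵘ.* toℚᵘ (ℕtoℚ b)             ≈⟨ toℚᵘ-homo-* (ℕtoℚ a) (ℕtoℚ b) ⟨
  toℚᵘ (ℕtoℚ a * ℕtoℚ b)                       ∎)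
  where open ℚᵘ.≃-Reasoning

ℕtoℚ-suc*1/suc : ∀ a → ℕtoℚ (suc a) * (ℤ.+ 1 ℚ./ suc a) ≡ 1ℚ
ℕtoℚ-suc*1/suc a = toℚᵘ-injective (begin
  toℚᵘ (ℕtoℚ (suc a) * (ℤ.+ 1 ℚ./ suc a))           ≈⟨ toℚᵘ-homo-* (ℕtoℚ (suc a)) (ℤ.+ 1 ℚ./ suc a) ⟩
  toℚᵘ (ℕtoℚ (suc a)) ℚᵘ.* toℚᵘ (ℤ.+ 1 ℚ./ suc a)  ≈⟨ ℚᵘ.*-cong (toℚᵘ-ℕtoℚ (suc a)) (toℚᵘ-fromℚᵘ (ℚᵘ.mkℚᵘ (ℤ.+ 1) a)) ⟩
  ℚᵘ.mkℚᵘ (ℤ.+ suc a) 0 ℚᵘ.* ℚᵘ.mkℚᵘ (ℤ.+ 1) a      ≈⟨ ℚᵘ.*≡* cross ⟩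
  ℚᵘ.1ℚᵘ                                            ∎)
  where
  open ℚᵘ.≃-Reasoning
  n = ℤ.+ suc a
  cross : (n ℤ.* ℤ.1ℤ) ℤ.* ℤ.1ℤ ≡ ℤ.1ℤ ℤ.* (ℤ.1ℤ ℤ.* n)
  cross = trans (ℤ.*-identityʳ (n ℤ.* ℤ.1ℤ)) (trans (ℤ.*-identityʳ n)
            (sym (trans (ℤ.*-identityˡ (ℤ.1ℤ ℤ.* n)) (ℤ.*-identityˡ n))))

0≤ℕtoℚ : ∀ a → 0ℚ ≤ ℕtoℚ a
0≤ℕtoℚ a = nonNegative⁻¹ _ {{normalize-nonNeg a 1}}

frac∈[0,1] : ∀ {a d} → a ℕ.≤ d → frac a d ∈[0,1]
frac∈[0,1] {a} {zero}  _   = ≤-refl , nonNegative⁻¹ 1ℚ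
frac∈[0,1] {a} {suc d} a≤d = nonNegative⁻¹ _ {{normalize-nonNeg a (suc d)}} ,
  toℚᵘ-cancel-≤ (ℚᵘ.≤-respˡ-≃ (ℚᵘ.≃-sym (toℚᵘ-fromℚᵘ (ℚᵘ.mkℚᵘ (ℤ.+ a) d)))
    (ℚᵘ.*≤* (subst₂ ℤ._≤_ (sym (ℤ.*-identityʳ (ℤ.+ a))) (sym (ℤ.*-identityˡ (ℤ.+ suc d))) (ℤ.+≤+ a≤d))))

-- Finite sums and products

∑ : List A → (A → ℚ) → ℚ
∑ xs f = sumℚ (map f xs)

∏ : List A → (A → ℚ) → ℚ
∏ xs f = prodℚ (map f xs)

infixr 10 ∑ ∏
syntax ∑ xs (λ x → e) = ∑[ x ∈ xs ] e
syntax ∏ xs (λ x → e) = ∏[ x ∈ xs ] e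

∑-cong : ∀ (xs : List A) {f g : A → ℚ} → (∀ x → f x ≡ g x) → ∑ xs f ≡ ∑ xs g
∑-cong xs f≗g = cong sumℚ (List.map-cong f≗g xs)

∏-cong : ∀ (xs : List A) {f g : A → ℚ} → (∀ x → f x ≡ g x) → ∏ xs f ≡ ∏ xs g
∏-cong xs f≗g = cong prodℚ (List.map-cong f≗g xs)

∑-++ : ∀ (xs ys : List A) f → ∑ (xs ++ ys) f ≡ ∑ xs f + ∑ ys f
∑-++ []       ys f = sym (+-identityˡ _)
∑-++ (x ∷ xs) ys f = trans (cong (f x +_) (∑-++ xs ys f)) (sym (+-assoc (f x) _ _))

∑-+ : ∀ (xs : List A) f g → ∑[ x ∈ xs ] (f x + g x) ≡ ∑ xs f + ∑ xs g
∑-+ []       f g = sym (+-identityˡ 0ℚ)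
∑-+ (x ∷ xs) f g = trans (cong (f x + g x +_) (∑-+ xs f g))
  (solve 4 (λ a b c d → (a :+ b) :+ (c :+ d) := (a :+ c) :+ (b :+ d)) refl (f x) (g x) (∑ xs f) (∑ xs g))

∑-*ˡ : ∀ (xs : List A) c f → ∑[ x ∈ xs ] (c * f x) ≡ c * ∑ xs f
∑-*ˡ []       c f = sym (*-zeroʳ c)
∑-*ˡ (x ∷ xs) c f = trans (cong (c * f x +_) (∑-*ˡ xs c f)) (sym (*-distribˡ-+ c (f x) _))

∑-*ʳ : ∀ (xs : List A) c f → ∑[ x ∈ xs ] (f x * c) ≡ ∑ xs f * c
∑-*ʳ xs c f = trans (∑-cong xs (λ x → *-comm (f x) c)) (trans (∑-*ˡ xs c f) (*-comm c _))

∑-const : ∀ (xs : List A) c → ∑[ _ ∈ xs ] c ≡ ℕtoℚ (length xs) * c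
∑-const []       c = sym (*-zeroˡ c)
∑-const (x ∷ xs) c = begin
  c + (∑[ _ ∈ xs ] c)           ≡⟨ cong (c +_) (∑-const xs c) ⟩
  c + ℕtoℚ (length xs) * c      ≡⟨ solve 2 (λ n c → c :+ n :* c := (con 1ℚ :+ n) :* c) refl (ℕtoℚ (length xs)) c ⟩
  (1ℚ + ℕtoℚ (length xs)) * c   ≡⟨ cong (_* c) (ℕtoℚ-+ 1 (length xs)) ⟨
  ℕtoℚ (suc (length xs)) * c    ∎
  where open ≡-Reasoning

∑-zero : ∀ (xs : List A) → ∑[ _ ∈ xs ] 0ℚ ≡ 0ℚ
∑-zero xs = trans (∑-const xs 0ℚ) (*-zeroʳ (ℕtoℚ (length xs)))

ℕtoℚ-length≡∑1 : ∀ (xs : List A) → ℕtoℚ (length xs) ≡ ∑[ _ ∈ xs ] 1ℚ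
ℕtoℚ-length≡∑1 xs = sym (trans (∑-const xs 1ℚ) (*-identityʳ _))

∑-minus-const : ∀ (xs : List A) f c → ∑[ x ∈ xs ] (f x - c) ≡ ∑ xs f - ℕtoℚ (length xs) * c
∑-minus-const xs f c = begin
  ∑[ x ∈ xs ] (f x - c)              ≡⟨ ∑-+ xs f (λ _ → - c) ⟩
  ∑ xs f + ∑[ _ ∈ xs ] (- c)         ≡⟨ cong (∑ xs f +_) (∑-const xs (- c)) ⟩
  ∑ xs f + ℕtoℚ (length xs) * (- c)  ≡⟨ cong (∑ xs f +_) (neg-distribʳ-* (ℕtoℚ (length xs)) c) ⟨
  ∑ xs f - ℕtoℚ (length xs) * c      ∎
  where open ≡-Reasoning

∑-square : ∀ (xs : List A) f → ∑ xs f * ∑ xs f ≡ ∑[ x ∈ xs ] ∑[ y ∈ xs ] (f x * f y)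
∑-square xs f = trans (sym (∑-*ʳ xs (∑ xs f) f)) (∑-cong xs (λ x → sym (∑-*ˡ xs (f x) f)))

∑-mono-≤ : ∀ (xs : List A) {f g : A → ℚ} → (∀ x → f x ≤ g x) → ∑ xs f ≤ ∑ xs g
∑-mono-≤ []       f≤g = ≤-refl
∑-mono-≤ (x ∷ xs) f≤g = +-mono-≤ (f≤g x) (∑-mono-≤ xs f≤g)

0≤∑ : ∀ (xs : List A) {f : A → ℚ} → (∀ x → 0ℚ ≤ f x) → 0ℚ ≤ ∑ xs f
0≤∑ xs 0≤f = ≤-trans (≤-reflexive (sym (∑-zero xs))) (∑-mono-≤ xs 0≤f)

∣∑∣≤∑∣∣ : ∀ (xs : List A) f → ∣ ∑ xs f ∣ ≤ ∑[ x ∈ xs ] ∣ f x ∣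
∣∑∣≤∑∣∣ []       f = ≤-refl
∣∑∣≤∑∣∣ (x ∷ xs) f = ≤-trans (∣p+q∣≤∣p∣+∣q∣ (f x) _) (+-monoʳ-≤ ∣ f x ∣ (∣∑∣≤∑∣∣ xs f))

∣∑∣≤length* : ∀ (xs : List A) {f b} → (∀ x → ∣ f x ∣ ≤ b) → ∣ ∑ xs f ∣ ≤ ℕtoℚ (length xs) * b
∣∑∣≤length* xs {f} {b} ∣f∣≤b = ≤-trans (∣∑∣≤∑∣∣ xs f) (≤-trans (∑-mono-≤ xs ∣f∣≤b) (≤-reflexive (∑-const xs b)))

∣∑∣≤*length-if-inhabited : ∀ (xs : List A) f {b} →
  (A → ∣ ∑ xs f ∣ ≤ b * ℕtoℚ (length xs)) → ∣ ∑ xs f ∣ ≤ b * ℕtoℚ (length xs)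
∣∑∣≤*length-if-inhabited []       f {b} _     = ≤-reflexive (sym (*-zeroʳ b))
∣∑∣≤*length-if-inhabited (x ∷ xs) f     bound = bound x

∑≡length*avg : ∀ (xs : List A) f → ∑ xs f ≡ ℕtoℚ (length xs) * avg xs f
∑≡length*avg []       f = sym (*-zeroˡ 0ℚ)
∑≡length*avg (x ∷ xs) f = begin
  ∑ (x ∷ xs) f            ≡⟨ *-identityˡ _ ⟨
  1ℚ * ∑ (x ∷ xs) f       ≡⟨ cong (_* ∑ (x ∷ xs) f) (ℕtoℚ-suc*1/suc (length xs)) ⟨
  n * r * ∑ (x ∷ xs) f    ≡⟨ solve 3 (λ n r s → n :* r :* s := n :* (s :* r)) refl n r (∑ (x ∷ xs) f) ⟩
  n * (∑ (x ∷ xs) f * r)  ∎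
  where
  open ≡-Reasoning
  n r : ℚ
  n = ℕtoℚ (suc (length xs))
  r = ℤ.+ 1 ℚ./ suc (length xs)

ℕtoℚ-length-filterᵇ : ∀ (q : A → Bool) xs → ℕtoℚ (length (filterᵇ q xs)) ≡ ∑[ x ∈ xs ] indicator (q x)
ℕtoℚ-length-filterᵇ q []       = refl
ℕtoℚ-length-filterᵇ q (x ∷ xs) with q x
... | true  = trans (ℕtoℚ-+ 1 (length (filterᵇ q xs))) (cong (1ℚ +_) (ℕtoℚ-length-filterᵇ q xs))
... | false = trans (ℕtoℚ-length-filterᵇ q xs) (sym (+-identityˡ _))

∑-map : ∀ (g : A → B) (xs : List A) f → ∑ (map g xs) f ≡ ∑[ x ∈ xs ] f (g x)
∑-map g xs f = cong sumℚ (sym (List.map-∘ xs))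

∑-concatMap : ∀ (g : A → List B) (xs : List A) f → ∑ (concatMap g xs) f ≡ ∑[ x ∈ xs ] ∑ (g x) f
∑-concatMap g []       f = refl
∑-concatMap g (x ∷ xs) f = trans (∑-++ (g x) (concatMap g xs) f) (cong (∑ (g x) f +_) (∑-concatMap g xs f))

∑-comm : ∀ (xs : List A) (ys : List B) (f : A → B → ℚ) →
  ∑[ x ∈ xs ] ∑[ y ∈ ys ] f x y ≡ ∑[ y ∈ ys ] ∑[ x ∈ xs ] f x y
∑-comm []       ys f = sym (∑-zero ys)
∑-comm (x ∷ xs) ys f = trans (cong (∑ ys (f x) +_) (∑-comm xs ys f)) (sym (∑-+ ys (f x) _))

∑-cartesianProduct : ∀ (xs : List A) (ys : List B) f →
  ∑ (List.cartesianProduct xs ys) f ≡ ∑[ x ∈ xs ] ∑[ y ∈ ys ] f (x , y)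
∑-cartesianProduct []       ys f = refl
∑-cartesianProduct (x ∷ xs) ys f = trans (∑-++ (map (x ,_) ys) _ f)
  (cong₂ _+_ (∑-map (x ,_) ys f) (∑-cartesianProduct xs ys f))

ℕtoℚ-length-cartesianProduct : ∀ (xs : List A) (ys : List B) →
  ℕtoℚ (length (List.cartesianProduct xs ys)) ≡ ℕtoℚ (length xs) * ℕtoℚ (length ys)
ℕtoℚ-length-cartesianProduct xs ys = begin
  ℕtoℚ (length (List.cartesianProduct xs ys))  ≡⟨ ℕtoℚ-length≡∑1 (List.cartesianProduct xs ys) ⟩
  ∑ (List.cartesianProduct xs ys) (λ _ → 1ℚ)   ≡⟨ ∑-cartesianProduct xs ys (λ _ → 1ℚ) ⟩
  ∑[ _ ∈ xs ] ∑[ _ ∈ ys ] 1ℚ                   ≡⟨ ∑-cong xs (λ _ → ℕtoℚ-length≡∑1 ys) ⟨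
  ∑[ _ ∈ xs ] ℕtoℚ (length ys)                 ≡⟨ ∑-const xs _ ⟩
  ℕtoℚ (length xs) * ℕtoℚ (length ys)          ∎
  where open ≡-Reasoning

prodℚ-++ : ∀ (ps qs : List ℚ) → prodℚ (ps ++ qs) ≡ prodℚ ps * prodℚ qs
prodℚ-++ []       qs = sym (*-identityˡ _)
prodℚ-++ (p ∷ ps) qs = trans (cong (p *_) (prodℚ-++ ps qs)) (sym (*-assoc p _ _))

prodℚ-concatMap : ∀ (g : A → List ℚ) xs → prodℚ (concatMap g xs) ≡ ∏[ x ∈ xs ] prodℚ (g x)
prodℚ-concatMap g []       = refl
prodℚ-concatMap g (x ∷ xs) =
  trans (prodℚ-++ (g x) (concatMap g xs)) (cong (prodℚ (g x) *_) (prodℚ-concatMap g xs))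

∏-cartesianProduct : ∀ (xs : List A) (ys : List B) f →
  ∏ (List.cartesianProduct xs ys) f ≡ ∏[ x ∈ xs ] ∏[ y ∈ ys ] f (x , y)
∏-cartesianProduct []       ys f = refl
∏-cartesianProduct (x ∷ xs) ys f = begin
  prodℚ (map f (map (x ,_) ys ++ List.cartesianProduct xs ys))
    ≡⟨ cong prodℚ (List.map-++ f (map (x ,_) ys) (List.cartesianProduct xs ys)) ⟩
  prodℚ (map f (map (x ,_) ys) ++ map f (List.cartesianProduct xs ys))
    ≡⟨ prodℚ-++ (map f (map (x ,_) ys)) (map f (List.cartesianProduct xs ys)) ⟩
  prodℚ (map f (map (x ,_) ys)) * ∏ (List.cartesianProduct xs ys) f
    ≡⟨ cong₂ _*_ (cong prodℚ (sym (List.map-∘ {g = f} {f = x ,_} ys))) (∏-cartesianProduct xs ys f) ⟩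
  ∏[ y ∈ ys ] f (x , y) * ∏[ x′ ∈ xs ] ∏[ y ∈ ys ] f (x′ , y) ∎
  where open ≡-Reasoning

indicator-allᵇ : ∀ (q : A → Bool) xs → indicator (allᵇ q xs) ≡ ∏[ x ∈ xs ] indicator (q x)
indicator-allᵇ q []       = refl
indicator-allᵇ q (x ∷ xs) with q x
... | true  = trans (indicator-allᵇ q xs) (sym (*-identityˡ _))
... | false = sym (*-zeroˡ (∏[ x ∈ xs ] indicator (q x)))

indicator∈[0,1] : ∀ b → indicator b ∈[0,1]
indicator∈[0,1] true  = 1∈[0,1]
indicator∈[0,1] false = ≤-refl , nonNegative⁻¹ 1ℚ

-- Cauchy–Schwarz and the box sum

lagrangeIdentity : ∀ (xs : List A) f →
  let n = ℕtoℚ (length xs); S = ∑ xs f; Q = ∑[ x ∈ xs ] (f x * f x) in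
  ∑[ x ∈ xs ] ∑[ y ∈ xs ] ((f x - f y) * (f x - f y)) ≡ (n * Q - S * S) + (n * Q - S * S)
lagrangeIdentity xs f = begin
  ∑[ x ∈ xs ] ∑[ y ∈ xs ] ((f x - f y) * (f x - f y))
    ≡⟨ ∑-cong xs (λ x → ∑-cong xs (λ y → expand (f x) (f y))) ⟩
  ∑[ x ∈ xs ] ∑[ y ∈ xs ] (f x * f x + (f y * f y + (- (f x + f x)) * f y))
    ≡⟨ ∑-cong xs inner ⟩
  ∑[ x ∈ xs ] (n * (f x * f x) + (Q + f x * (- (S + S))))
    ≡⟨ ∑-+ xs _ _ ⟩
  ∑[ x ∈ xs ] (n * (f x * f x)) + ∑[ x ∈ xs ] (Q + f x * (- (S + S)))
    ≡⟨ cong₂ _+_ (∑-*ˡ xs n _) (trans (∑-+ xs _ _) (cong₂ _+_ (∑-const xs Q) (∑-*ʳ xs _ f))) ⟩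
  n * Q + (n * Q + S * (- (S + S)))
    ≡⟨ solve 3 (λ n Q S → n :* Q :+ (n :* Q :+ S :* (:- (S :+ S))) := (n :* Q :- S :* S) :+ (n :* Q :- S :* S))
         refl n Q S ⟩
  (n * Q - S * S) + (n * Q - S * S) ∎
  where
  open ≡-Reasoning
  n S Q : ℚ
  n = ℕtoℚ (length xs)
  S = ∑ xs f
  Q = ∑[ x ∈ xs ] (f x * f x)
  expand : ∀ a b → (a - b) * (a - b) ≡ a * a + (b * b + (- (a + a)) * b)
  expand = solve 2 (λ a b → (a :- b) :* (a :- b) := a :* a :+ (b :* b :+ (:- (a :+ a)) :* b)) refl
  inner : ∀ x → ∑[ y ∈ xs ] (f x * f x + (f y * f y + (- (f x + f x)) * f y))
              ≡ n * (f x * f x) + (Q + f x * (- (S + S)))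
  inner x = begin
    ∑[ y ∈ xs ] (f x * f x + (f y * f y + (- (f x + f x)) * f y))
      ≡⟨ trans (∑-+ xs _ _) (cong₂ _+_ (∑-const xs _) (trans (∑-+ xs _ _) (cong (Q +_) (∑-*ˡ xs (- (f x + f x)) f)))) ⟩
    n * (f x * f x) + (Q + (- (f x + f x)) * S)
      ≡⟨ cong (λ e → n * (f x * f x) + (Q + e)) (solve 2 (λ a s → (:- (a :+ a)) :* s := a :* (:- (s :+ s))) refl (f x) S) ⟩
    n * (f x * f x) + (Q + f x * (- (S + S))) ∎

cauchySchwarz : ∀ (xs : List A) f → ∑ xs f * ∑ xs f ≤ ℕtoℚ (length xs) * ∑[ x ∈ xs ] (f x * f x)
cauchySchwarz xs f = 0≤p-q⇒q≤p (begin
  0ℚ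
    ≤⟨ 0≤* (nonNegative⁻¹ ½) (0≤∑ xs λ x → 0≤∑ xs λ y → 0≤p*p (f x - f y)) ⟩
  ½ * ∑[ x ∈ xs ] ∑[ y ∈ xs ] ((f x - f y) * (f x - f y))
    ≡⟨ cong (½ *_) (lagrangeIdentity xs f) ⟩
  ½ * (D + D)
    ≡⟨ solve 1 (λ D → con ½ :* (D :+ D) := D) refl D ⟩
  D ∎)
  where
  open ≤-Reasoning
  D : ℚ
  D = ℕtoℚ (length xs) * ∑[ x ∈ xs ] (f x * f x) - ∑ xs f * ∑ xs f

cauchySchwarz-weighted : ∀ (xs : List A) (a F : A → ℚ) → (∀ x → a x ∈[0,1]) →
  ∑[ x ∈ xs ] (a x * F x) * ∑[ x ∈ xs ] (a x * F x) ≤ ℕtoℚ (length xs) * ∑[ x ∈ xs ] (F x * F x)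
cauchySchwarz-weighted xs a F a∈[0,1] = ≤-trans (cauchySchwarz xs (λ x → a x * F x))
  (*-monoˡ-≤-0≤ (0≤ℕtoℚ (length xs)) (∑-mono-≤ xs weight-drops))
  where
  weight-drops : ∀ x → (a x * F x) * (a x * F x) ≤ F x * F x
  weight-drops x = begin
    (a x * F x) * (a x * F x)  ≡⟨ solve 2 (λ a f → (a :* f) :* (a :* f) := (a :* a) :* (f :* f)) refl (a x) (F x) ⟩
    (a x * a x) * (F x * F x)  ≤⟨ *-monoʳ-≤-0≤ (0≤p*p (F x)) (proj₂ (∈[0,1]-* (a∈[0,1] x) (a∈[0,1] x))) ⟩
    1ℚ * (F x * F x)           ≡⟨ *-identityˡ _ ⟩
    F x * F x                  ∎
    where open ≤-Reasoning

boxSum : List A → List B → (A → B → ℚ) → ℚ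
boxSum X Y H = ∑[ t ∈ X ] ∑[ t′ ∈ X ] ∑[ s ∈ Y ] ∑[ s′ ∈ Y ] (H t s * H t s′ * H t′ s * H t′ s′)

-- U2⁴ p 𝓛 f a₁ a₂ unfolds to boxAvg (L p 𝓛 a₁) (L p 𝓛 a₂) (λ t s → f (t +V s)).
boxAvg : List A → List B → (A → B → ℚ) → ℚ
boxAvg X Y H = avg X λ t → avg X λ t′ → avg Y λ s → avg Y λ s′ → H t s * H t s′ * H t′ s * H t′ s′

boxSum-cong : ∀ (X : List A) (Y : List B) {H H′} → (∀ t s → H t s ≡ H′ t s) → boxSum X Y H ≡ boxSum X Y H′
boxSum-cong X Y H≗H′ =
  ∑-cong X λ t → ∑-cong X λ t′ → ∑-cong Y λ s → ∑-cong Y λ s′ →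
    cong₂ _*_ (cong₂ _*_ (cong₂ _*_ (H≗H′ t s) (H≗H′ t s′)) (H≗H′ t′ s)) (H≗H′ t′ s′)

boxSum-neg : ∀ (X : List A) (Y : List B) H → boxSum X Y (λ t s → - H t s) ≡ boxSum X Y H
boxSum-neg X Y H =
  ∑-cong X λ t → ∑-cong X λ t′ → ∑-cong Y λ s → ∑-cong Y λ s′ →
    solve 4 (λ a b c d → (:- a) :* (:- b) :* (:- c) :* (:- d) := a :* b :* c :* d) refl
      (H t s) (H t s′) (H t′ s) (H t′ s′)

boxSum≡sizes*boxAvg : ∀ {A B : Set} (X : List A) (Y : List B) H →
  let nX = ℕtoℚ (length X); nY = ℕtoℚ (length Y) in
  boxSum X Y H ≡ (nX * nX) * (nY * nY) * boxAvg X Y H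
boxSum≡sizes*boxAvg {A} {B} X Y H = begin
  boxSum X Y H                                    ≡⟨ unfold-averages ⟩
  ((((1ℚ * nY) * nY) * nX) * nX) * boxAvg X Y H   ≡⟨ cong (_* boxAvg X Y H) (solve 2 (λ x y →
                                                       con 1ℚ :* y :* y :* x :* x := (x :* x) :* (y :* y)) refl nX nY) ⟩
  (nX * nX) * (nY * nY) * boxAvg X Y H            ∎
  where
  open ≡-Reasoning
  nX nY : ℚ
  nX = ℕtoℚ (length X)
  nY = ℕtoℚ (length Y)
  P : A → A → B → B → ℚ
  P t t′ s s′ = H t s * H t s′ * H t′ s * H t′ s′
  ∑-scaled : ∀ {C : Set} (xs : List C) (g : C → ℚ) r {f} → (∀ x → f x ≡ r * g x) →
    ∑ xs f ≡ (r * ℕtoℚ (length xs)) * avg xs g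
  ∑-scaled xs g r {f} f≡rg = begin
    ∑ xs f                             ≡⟨ trans (∑-cong xs f≡rg) (∑-*ˡ xs r g) ⟩
    r * ∑ xs g                         ≡⟨ cong (r *_) (∑≡length*avg xs g) ⟩
    r * (ℕtoℚ (length xs) * avg xs g)  ≡⟨ *-assoc r _ _ ⟨
    (r * ℕtoℚ (length xs)) * avg xs g  ∎
  unfold-averages : boxSum X Y H ≡ ((((1ℚ * nY) * nY) * nX) * nX) * boxAvg X Y H
  unfold-averages =
    ∑-scaled X (λ t → avg X λ t′ → avg Y λ s → avg Y (P t t′ s)) (((1ℚ * nY) * nY) * nX) λ t →
    ∑-scaled X (λ t′ → avg Y λ s → avg Y (P t t′ s)) ((1ℚ * nY) * nY) λ t′ →
    ∑-scaled Y (λ s → avg Y (P t t′ s)) (1ℚ * nY) λ s →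
    ∑-scaled Y (P t t′ s) 1ℚ λ s′ → sym (*-identityˡ (P t t′ s s′))

gowersCauchySchwarz : ∀ {A B : Set} (X : List A) (Y : List B) (a : A → ℚ) (b : B → ℚ) H →
  (∀ t → a t ∈[0,1]) → (∀ s → b s ∈[0,1]) →
  let S = ∑[ t ∈ X ] ∑[ s ∈ Y ] (a t * b s * H t s); nX = ℕtoℚ (length X); nY = ℕtoℚ (length Y) in
  (S * S) * (S * S) ≤ (nX * nX) * (nY * nY) * boxSum X Y H
gowersCauchySchwarz {A} {B} X Y a b H a∈[0,1] b∈[0,1] = begin
  (S * S) * (S * S)                          ≤⟨ *-self-mono-≤ (0≤p*p S) S²≤ ⟩
  (nX * M) * (nX * M)                        ≡⟨ solve 2 (λ n m → (n :* m) :* (n :* m) := (n :* n) :* (m :* m)) refl nX M ⟩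
  (nX * nX) * (M * M)                        ≤⟨ *-monoˡ-≤-0≤ (0≤p*p nX) M²≤ ⟩
  (nX * nX) * (nY * ∑[ s ∈ Y ] (G s * G s))  ≤⟨ *-monoˡ-≤-0≤ (0≤p*p nX) (*-monoˡ-≤-0≤ (0≤ℕtoℚ (length Y)) ∑G²≤) ⟩
  (nX * nX) * (nY * (nY * ∑K²))              ≡⟨ solve 3 (λ x y k → (x :* x) :* (y :* (y :* k)) := (x :* x) :* (y :* y) :* k)
                                                  refl nX nY ∑K² ⟩
  (nX * nX) * (nY * nY) * ∑K²                ≡⟨ cong ((nX * nX) * (nY * nY) *_) ∑K²≡boxSum ⟩
  (nX * nX) * (nY * nY) * boxSum X Y H       ∎
  where
  open ≤-Reasoning
  nX nY S M ∑K² : ℚ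
  F : A → ℚ
  K : B → B → ℚ
  G : B → ℚ
  nX = ℕtoℚ (length X)
  nY = ℕtoℚ (length Y)
  S = ∑[ t ∈ X ] ∑[ s ∈ Y ] (a t * b s * H t s)
  F t = ∑[ s ∈ Y ] (b s * H t s)
  K s s′ = ∑[ t ∈ X ] (H t s * H t s′)
  G s = ∑[ s′ ∈ Y ] (b s′ * K s s′)
  M = ∑[ t ∈ X ] (F t * F t)
  ∑K² = ∑[ s ∈ Y ] ∑[ s′ ∈ Y ] (K s s′ * K s s′)

  S≡ : S ≡ ∑[ t ∈ X ] (a t * F t)
  S≡ = ∑-cong X (λ t → trans (∑-cong Y (λ s → *-assoc (a t) (b s) (H t s))) (∑-*ˡ Y (a t) _))

  M≡ : M ≡ ∑[ s ∈ Y ] (b s * G s)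
  M≡ = begin-equality
    ∑[ t ∈ X ] (F t * F t)
      ≡⟨ ∑-cong X (λ t → ∑-square Y (λ s → b s * H t s)) ⟩
    ∑[ t ∈ X ] ∑[ s ∈ Y ] ∑[ s′ ∈ Y ] ((b s * H t s) * (b s′ * H t s′))
      ≡⟨ trans (∑-comm X Y _) (∑-cong Y (λ s → ∑-comm X Y _)) ⟩
    ∑[ s ∈ Y ] ∑[ s′ ∈ Y ] ∑[ t ∈ X ] ((b s * H t s) * (b s′ * H t s′))
      ≡⟨ ∑-cong Y (λ s → trans (∑-cong Y (λ s′ → pull s s′)) (∑-*ˡ Y (b s) _)) ⟩
    ∑[ s ∈ Y ] (b s * G s) ∎
    where
    pull : ∀ s s′ → ∑[ t ∈ X ] ((b s * H t s) * (b s′ * H t s′)) ≡ b s * (b s′ * K s s′)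
    pull s s′ = trans
      (∑-cong X (λ t → solve 4 (λ b b′ h h′ → (b :* h) :* (b′ :* h′) := b :* (b′ :* (h :* h′))) refl
                         (b s) (b s′) (H t s) (H t s′)))
      (trans (∑-*ˡ X (b s) _) (cong (b s *_) (∑-*ˡ X (b s′) _)))

  ∑K²≡boxSum : ∑K² ≡ boxSum X Y H
  ∑K²≡boxSum = begin-equality
    ∑[ s ∈ Y ] ∑[ s′ ∈ Y ] (K s s′ * K s s′)
      ≡⟨ ∑-cong Y (λ s → ∑-cong Y (λ s′ → ∑-square X (λ t → H t s * H t s′))) ⟩
    ∑[ s ∈ Y ] ∑[ s′ ∈ Y ] ∑[ t ∈ X ] ∑[ t′ ∈ X ] ((H t s * H t s′) * (H t′ s * H t′ s′))
      ≡⟨ trans (∑-cong Y (λ s → ∑-comm Y X _)) (∑-comm Y X _) ⟩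
    ∑[ t ∈ X ] ∑[ s ∈ Y ] ∑[ s′ ∈ Y ] ∑[ t′ ∈ X ] ((H t s * H t s′) * (H t′ s * H t′ s′))
      ≡⟨ ∑-cong X (λ t → trans (∑-cong Y (λ s → ∑-comm Y X _)) (∑-comm Y X _)) ⟩
    ∑[ t ∈ X ] ∑[ t′ ∈ X ] ∑[ s ∈ Y ] ∑[ s′ ∈ Y ] ((H t s * H t s′) * (H t′ s * H t′ s′))
      ≡⟨ ∑-cong X (λ t → ∑-cong X λ t′ → ∑-cong Y λ s → ∑-cong Y λ s′ →
           sym (*-assoc (H t s * H t s′) (H t′ s) (H t′ s′))) ⟩
    boxSum X Y H ∎

  S²≤ : S * S ≤ nX * M
  S²≤ = subst (λ e → e * e ≤ nX * M) (sym S≡) (cauchySchwarz-weighted X a F a∈[0,1])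

  M²≤ : M * M ≤ nY * ∑[ s ∈ Y ] (G s * G s)
  M²≤ = subst (λ e → e * e ≤ nY * ∑[ s ∈ Y ] (G s * G s)) (sym M≡) (cauchySchwarz-weighted Y b G b∈[0,1])

  ∑G²≤ : ∑[ s ∈ Y ] (G s * G s) ≤ nY * ∑K²
  ∑G²≤ = ≤-trans (∑-mono-≤ Y (λ s → cauchySchwarz-weighted Y b (K s) b∈[0,1])) (≤-reflexive (∑-*ˡ Y nY _))

rectangleSum-bound : ∀ (X : List A) (Y : List B) (a : A → ℚ) (b : B → ℚ) H {ε} → 0ℚ ≤ ε →
  (∀ t → a t ∈[0,1]) → (∀ s → b s ∈[0,1]) →
  let nX = ℕtoℚ (length X); nY = ℕtoℚ (length Y) in
  boxSum X Y H ≤ ε * ε * ε * ε * ((nX * nX) * (nY * nY)) →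
  ∣ ∑[ t ∈ X ] ∑[ s ∈ Y ] (a t * b s * H t s) ∣ ≤ ε * (nX * nY)
rectangleSum-bound X Y a b H {ε} 0≤ε a∈[0,1] b∈[0,1] box≤ =
  p⁴≤q⁴⇒∣p∣≤q (0≤* 0≤ε (0≤* (0≤ℕtoℚ (length X)) (0≤ℕtoℚ (length Y)))) (begin
    (S * S) * (S * S)        ≤⟨ gowersCauchySchwarz X Y a b H a∈[0,1] b∈[0,1] ⟩
    N * boxSum X Y H         ≤⟨ *-monoˡ-≤-0≤ (0≤* (0≤p*p nX) (0≤p*p nY)) box≤ ⟩
    N * (ε * ε * ε * ε * N)  ≡⟨ solve 3 (λ e x y → ((x :* x) :* (y :* y)) :* (e :* e :* e :* e :* ((x :* x) :* (y :* y)))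
                                   := ((e :* (x :* y)) :* (e :* (x :* y))) :* ((e :* (x :* y)) :* (e :* (x :* y))))
                                   refl ε nX nY ⟩
    ((ε * (nX * nY)) * (ε * (nX * nY))) * ((ε * (nX * nY)) * (ε * (nX * nY))) ∎)
  where
  open ≤-Reasoning
  nX nY N S : ℚ
  nX = ℕtoℚ (length X)
  nY = ℕtoℚ (length Y)
  N = (nX * nX) * (nY * nY)
  S = ∑[ t ∈ X ] ∑[ s ∈ Y ] (a t * b s * H t s)

-- Sums over tuples

length-concatMap-map : ∀ {C : Set} (g : A → B → C) xs ys →
  length (concatMap (λ x → map (g x) ys) xs) ≡ length xs ℕ.* length ys
length-concatMap-map g []       ys = refl
length-concatMap-map g (x ∷ xs) ys = trans (List.length-++ (map (g x) ys))
  (cong₂ ℕ._+_ (List.length-map (g x) ys) (length-concatMap-map g xs ys))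

module _ (p : ℕ) .{{_ : NonZero p}} where

  tuplesOf : ∀ {k} → (Fin k → List A) → List (Vec A k)
  tuplesOf X = tuples p (tabulate X)

  ∑-tuplesOf-suc : ∀ {k} (X : Fin (suc k) → List A) F →
    ∑ (tuplesOf X) F ≡ ∑[ x₀ ∈ X zero ] ∑[ xs ∈ tuplesOf (X ∘ suc) ] F (x₀ ∷ xs)
  ∑-tuplesOf-suc X F =
    trans (∑-concatMap _ (X zero) F) (∑-cong (X zero) (λ x₀ → ∑-map (x₀ ∷_) (tuplesOf (X ∘ suc)) F))

  length-tuplesOf-suc : ∀ {k} (X : Fin (suc k) → List A) →
    length (tuplesOf X) ≡ length (X zero) ℕ.* length (tuplesOf (X ∘ suc))
  length-tuplesOf-suc X = length-concatMap-map _∷_ (X zero) (tuplesOf (X ∘ suc))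

  ℕtoℚ-length-tuplesOf-suc : ∀ {k} (X : Fin (suc k) → List A) →
    ℕtoℚ (length (tuplesOf X)) ≡ ℕtoℚ (length (X zero)) * ℕtoℚ (length (tuplesOf (X ∘ suc)))
  ℕtoℚ-length-tuplesOf-suc X =
    trans (cong ℕtoℚ (length-tuplesOf-suc X)) (ℕtoℚ-* (length (X zero)) (length (tuplesOf (X ∘ suc))))

  length-tuplesOf : ∀ {k} (X : Fin k → List A) → length (tuplesOf X) ≡ ℕ.product (map (length ∘ X) (List.allFin k))
  length-tuplesOf {k = zero}  X = refl
  length-tuplesOf {k = suc k} X = trans (length-tuplesOf-suc X) (cong (length (X zero) ℕ.*_) (begin
    length (tuplesOf (X ∘ suc))                        ≡⟨ length-tuplesOf (X ∘ suc) ⟩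
    ℕ.product (map (length ∘ X ∘ suc) (List.allFin k))  ≡⟨ cong ℕ.product (List.map-tabulate id (length ∘ X ∘ suc)) ⟩
    ℕ.product (List.tabulate (length ∘ X ∘ suc))        ≡⟨ cong ℕ.product (List.map-tabulate suc (length ∘ X)) ⟨
    ℕ.product (map (length ∘ X) (List.tabulate suc))    ∎))
    where open ≡-Reasoning

  ∣∑-tuplesOf∣≤-by-slices : ∀ {k} (X : Fin k → List A) (u : Fin k) (F : Vec A k → ℚ) (b : ℚ) →
    (∀ x → ∣ ∑[ t ∈ X u ] F (x [ u ]≔ t) ∣ ≤ b * ℕtoℚ (length (X u))) →
    ∣ ∑ (tuplesOf X) F ∣ ≤ b * ℕtoℚ (length (tuplesOf X))
  ∣∑-tuplesOf∣≤-by-slices X zero F b slice≤ = begin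
    ∣ ∑ (tuplesOf X) F ∣
      ≡⟨ cong ∣_∣ (trans (∑-tuplesOf-suc X F) (∑-comm (X zero) (tuplesOf (X ∘ suc)) (λ x₀ xs → F (x₀ ∷ xs)))) ⟩
    ∣ ∑[ xs ∈ tuplesOf (X ∘ suc) ] ∑[ x₀ ∈ X zero ] F (x₀ ∷ xs) ∣  ≤⟨ ∣∑∣≤length* (tuplesOf (X ∘ suc)) column≤ ⟩
    n′ * (b * n₀)                                    ≡⟨ solve 3 (λ m b n → m :* (b :* n) := b :* (n :* m)) refl n′ b n₀ ⟩
    b * (n₀ * n′)                                    ≡⟨ cong (b *_) (ℕtoℚ-length-tuplesOf-suc X) ⟨
    b * ℕtoℚ (length (tuplesOf X))                   ∎
    where
    open ≤-Reasoning
    n₀ n′ : ℚ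
    n₀ = ℕtoℚ (length (X zero))
    n′ = ℕtoℚ (length (tuplesOf (X ∘ suc)))
    column≤ : ∀ xs → ∣ ∑[ x₀ ∈ X zero ] F (x₀ ∷ xs) ∣ ≤ b * n₀
    column≤ xs = ∣∑∣≤*length-if-inhabited (X zero) (λ x₀ → F (x₀ ∷ xs)) {b} (λ x₀ → slice≤ (x₀ ∷ xs))
  ∣∑-tuplesOf∣≤-by-slices X (suc u) F b slice≤ = begin
    ∣ ∑ (tuplesOf X) F ∣                                           ≡⟨ cong ∣_∣ (∑-tuplesOf-suc X F) ⟩
    ∣ ∑[ x₀ ∈ X zero ] ∑[ xs ∈ tuplesOf (X ∘ suc) ] F (x₀ ∷ xs) ∣  ≤⟨ ∣∑∣≤length* (X zero) row≤ ⟩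
    n₀ * (b * n′)                                    ≡⟨ solve 3 (λ n b m → n :* (b :* m) := b :* (n :* m)) refl n₀ b n′ ⟩
    b * (n₀ * n′)                                    ≡⟨ cong (b *_) (ℕtoℚ-length-tuplesOf-suc X) ⟨
    b * ℕtoℚ (length (tuplesOf X))                   ∎
    where
    open ≤-Reasoning
    n₀ n′ : ℚ
    n₀ = ℕtoℚ (length (X zero))
    n′ = ℕtoℚ (length (tuplesOf (X ∘ suc)))
    row≤ : ∀ x₀ → ∣ ∑[ xs ∈ tuplesOf (X ∘ suc) ] F (x₀ ∷ xs) ∣ ≤ b * n′
    row≤ x₀ = ∣∑-tuplesOf∣≤-by-slices (X ∘ suc) u (λ xs → F (x₀ ∷ xs)) b (λ xs → slice≤ (x₀ ∷ xs))

-- The counting lemma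

telescoping-bound : ∀ {I Z : Set} (D : List Z) (g : I → Z → ℚ) (c : I → ℚ) → (∀ i → ∣ c i ∣ ≤ 1ℚ) → ∀ {b} →
  (∀ i R → All (i ≢_) R → ∣ ∑[ z ∈ D ] ((g i z - c i) * ∏[ j ∈ R ] g j z) ∣ ≤ b) →
  ∀ P → Unique P → ∣ ∑[ z ∈ D ] (∏[ j ∈ P ] g j z - ∏ P c) ∣ ≤ ℕtoℚ (length P) * b
telescoping-bound D g c ∣c∣≤1 {b} step≤ [] [] = begin
  ∣ ∑[ _ ∈ D ] (1ℚ - 1ℚ) ∣  ≡⟨ cong ∣_∣ (trans (∑-cong D (λ _ → +-inverseʳ 1ℚ)) (∑-zero D)) ⟩
  0ℚ                       ≡⟨ *-zeroˡ b ⟨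
  0ℚ * b                   ∎
  where open ≤-Reasoning
telescoping-bound D g c ∣c∣≤1 {b} step≤ (i ∷ P) (i∉P ∷ P-unique) = begin
  ∣ ∑[ z ∈ D ] (∏[ j ∈ i ∷ P ] g j z - ∏ (i ∷ P) c) ∣   ≡⟨ cong ∣_∣ split ⟩
  ∣ first + c i * rest ∣                               ≤⟨ ∣p+q∣≤∣p∣+∣q∣ first (c i * rest) ⟩
  ∣ first ∣ + ∣ c i * rest ∣                           ≤⟨ +-mono-≤ (step≤ i P i∉P) ∣c*rest∣≤ ⟩
  b + ℕtoℚ (length P) * b                              ≡⟨ solve 2 (λ b n → b :+ n :* b := (con 1ℚ :+ n) :* b)
                                                            refl b (ℕtoℚ (length P)) ⟩
  (1ℚ + ℕtoℚ (length P)) * b                           ≡⟨ cong (_* b) (ℕtoℚ-+ 1 (length P)) ⟨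
  ℕtoℚ (length (i ∷ P)) * b                            ∎
  where
  open ≤-Reasoning
  first rest : ℚ
  first = ∑[ z ∈ D ] ((g i z - c i) * ∏[ j ∈ P ] g j z)
  rest = ∑[ z ∈ D ] (∏[ j ∈ P ] g j z - ∏ P c)
  split : ∑[ z ∈ D ] (∏[ j ∈ i ∷ P ] g j z - ∏ (i ∷ P) c) ≡ first + c i * rest
  split = trans
    (∑-cong D (λ z → solve 4 (λ a c p q → a :* p :- c :* q := (a :- c) :* p :+ c :* (p :- q)) refl
                       (g i z) (c i) (∏[ j ∈ P ] g j z) (∏ P c)))
    (trans (∑-+ D _ _) (cong (first +_) (∑-*ˡ D (c i) _)))
  ∣c*rest∣≤ : ∣ c i * rest ∣ ≤ ℕtoℚ (length P) * b
  ∣c*rest∣≤ = begin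
    ∣ c i * rest ∣        ≡⟨ ∣p*q∣≡∣p∣*∣q∣ (c i) rest ⟩
    ∣ c i ∣ * ∣ rest ∣    ≤⟨ *-monoʳ-≤-0≤ (0≤∣p∣ rest) (∣c∣≤1 i) ⟩
    1ℚ * ∣ rest ∣         ≡⟨ *-identityˡ ∣ rest ∣ ⟩
    ∣ rest ∣              ≤⟨ telescoping-bound D g c ∣c∣≤1 step≤ P P-unique ⟩
    ℕtoℚ (length P) * b   ∎

record Rectangular (h : A → B → ℚ) : Set where
  field
    row        : A → ℚ
    col        : B → ℚ
    row∈[0,1]  : ∀ t → row t ∈[0,1]
    col∈[0,1]  : ∀ s → col s ∈[0,1]
    factorises : ∀ t s → h t s ≡ row t * col s

rectangular-one : Rectangular {A} {B} (λ _ _ → 1ℚ)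
rectangular-one = record
  { row = λ _ → 1ℚ ; col = λ _ → 1ℚ ; row∈[0,1] = λ _ → 1∈[0,1] ; col∈[0,1] = λ _ → 1∈[0,1]
  ; factorises = λ _ _ → sym (*-identityˡ 1ℚ) }

rectangular-*row : ∀ {h : A → B → ℚ} (g : A → ℚ) → (∀ t → g t ∈[0,1]) →
  Rectangular h → Rectangular (λ t s → g t * h t s)
rectangular-*row g g∈[0,1] r = record
  { row = λ t → g t * row t ; col = col
  ; row∈[0,1] = λ t → ∈[0,1]-* (g∈[0,1] t) (row∈[0,1] t) ; col∈[0,1] = col∈[0,1]
  ; factorises = λ t s → trans (cong (g t *_) (factorises t s)) (sym (*-assoc (g t) (row t) (col s))) }
  where open Rectangular r

rectangular-*col : ∀ {h : A → B → ℚ} (g : B → ℚ) → (∀ s → g s ∈[0,1]) →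
  Rectangular h → Rectangular (λ t s → g s * h t s)
rectangular-*col g g∈[0,1] r = record
  { row = row ; col = λ s → g s * col s
  ; row∈[0,1] = row∈[0,1] ; col∈[0,1] = λ s → ∈[0,1]-* (g∈[0,1] s) (col∈[0,1] s)
  ; factorises = λ t s → trans (cong (g s *_) (factorises t s))
      (solve 3 (λ g a b → g :* (a :* b) := a :* (g :* b)) refl (g s) (row t) (col s)) }
  where open Rectangular r

rectangular-resp : ∀ {h h′ : A → B → ℚ} → (∀ t s → h t s ≡ h′ t s) → Rectangular h → Rectangular h′
rectangular-resp h≗h′ r = record
  { row = row ; col = col ; row∈[0,1] = row∈[0,1] ; col∈[0,1] = col∈[0,1]
  ; factorises = λ t s → trans (sym (h≗h′ t s)) (factorises t s) }
  where open Rectangular r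

module CountingLemma (p : ℕ) .{{_ : NonZero p}} {T S : Set} {k m : ℕ}
  (X : Fin k → List T) (Y : Fin m → List S)
  (G : Fin k → Fin m → T → S → ℚ) (G∈[0,1] : ∀ u v t s → G u v t s ∈[0,1]) where

  Index Config : Set
  Index = Fin k × Fin m
  Config = Vec T k × Vec S m

  weight : Index → Config → ℚ
  weight (u , v) (x , y) = G u v (lookup x u) (lookup y v)

  indices : List Index
  indices = List.cartesianProduct (List.allFin k) (List.allFin m)

  configs : List Config
  configs = List.cartesianProduct (tuplesOf p X) (tuplesOf p Y)

  nX nY totalWeight : ℚ
  nX = ℕtoℚ (length (tuplesOf p X))
  nY = ℕtoℚ (length (tuplesOf p Y))
  totalWeight =
    ∑[ x ∈ tuplesOf p X ] ∑[ y ∈ tuplesOf p Y ] ∏[ u ∈ List.allFin k ] ∏[ v ∈ List.allFin m ] G u v (lookup x u) (lookup y v)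

  ∏-weight-rectangular : ∀ u v x y R → All ((u , v) ≢_) R →
    Rectangular (λ t s → ∏[ j ∈ R ] weight j (x [ u ]≔ t , y [ v ]≔ s))
  ∏-weight-rectangular u v x y [] [] = rectangular-one
  ∏-weight-rectangular u v x y ((u′ , v′) ∷ R) (uv≢u′v′ ∷ uv∉R)
    with ∏-weight-rectangular u v x y R uv∉R | u′ Fin.≟ u | v′ Fin.≟ v
  ... | _    | yes refl | yes refl = ⊥-elim (uv≢u′v′ refl)
  ... | rest | yes refl | no v′≢v  = rectangular-resp
    (λ t s → cong (_* ∏[ j ∈ R ] weight j (x [ u ]≔ t , y [ v ]≔ s))
                  (cong₂ (G u v′) (sym (lookup∘update u x t)) (sym (lookup∘update′ v′≢v y s))))
    (rectangular-*row (λ t → G u v′ t (lookup y v′)) (λ t → G∈[0,1] u v′ t (lookup y v′)) rest)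
  ... | rest | no u′≢u  | yes refl = rectangular-resp
    (λ t s → cong (_* ∏[ j ∈ R ] weight j (x [ u ]≔ t , y [ v ]≔ s))
                  (cong₂ (G u′ v) (sym (lookup∘update′ u′≢u x t)) (sym (lookup∘update v y s))))
    (rectangular-*col (λ s → G u′ v (lookup x u′) s) (λ s → G∈[0,1] u′ v (lookup x u′) s) rest)
  ... | rest | no u′≢u  | no v′≢v  = rectangular-resp
    (λ t s → cong (_* ∏[ j ∈ R ] weight j (x [ u ]≔ t , y [ v ]≔ s))
                  (cong₂ (G u′ v′) (sym (lookup∘update′ u′≢u x t)) (sym (lookup∘update′ v′≢v y s))))
    (rectangular-*row (λ _ → G u′ v′ (lookup x u′) (lookup y v′))
                      (λ _ → G∈[0,1] u′ v′ (lookup x u′) (lookup y v′)) rest)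

  deviation-bound : ∀ {ε} → 0ℚ ≤ ε → ∀ u v c →
    let nU = ℕtoℚ (length (X u)); nV = ℕtoℚ (length (Y v)) in
    boxSum (X u) (Y v) (λ t s → G u v t s - c) ≤ ε * ε * ε * ε * ((nU * nU) * (nV * nV)) →
    ∀ R → All ((u , v) ≢_) R →
    ∣ ∑[ z ∈ configs ] ((weight (u , v) z - c) * ∏[ j ∈ R ] weight j z) ∣ ≤ ε * (nX * nY)
  deviation-bound {ε} 0≤ε u v c box≤ R uv∉R = begin
    ∣ ∑[ z ∈ configs ] W′ z ∣
      ≡⟨ cong ∣_∣ (∑-cartesianProduct (tuplesOf p X) (tuplesOf p Y) W′) ⟩
    ∣ ∑[ x ∈ tuplesOf p X ] ∑[ y ∈ tuplesOf p Y ] W x y ∣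
      ≤⟨ ∣∑-tuplesOf∣≤-by-slices p X u (λ x → ∑[ y ∈ tuplesOf p Y ] W x y) (ε * nY) sliceX≤ ⟩
    ε * nY * nX
      ≡⟨ solve 3 (λ e y x → e :* y :* x := e :* (x :* y)) refl ε nY nX ⟩
    ε * (nX * nY) ∎
    where
    open ≤-Reasoning
    nU nV : ℚ
    nU = ℕtoℚ (length (X u))
    nV = ℕtoℚ (length (Y v))
    W : Vec T k → Vec S m → ℚ
    W x y = (weight (u , v) (x , y) - c) * ∏[ j ∈ R ] weight j (x , y)
    W′ : Config → ℚ
    W′ (x , y) = W x y

    sliceXY≤ : ∀ x y → ∣ ∑[ s ∈ Y v ] ∑[ t ∈ X u ] W (x [ u ]≔ t) (y [ v ]≔ s) ∣ ≤ ε * nU * nV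
    sliceXY≤ x y = begin
      ∣ ∑[ s ∈ Y v ] ∑[ t ∈ X u ] W (x [ u ]≔ t) (y [ v ]≔ s) ∣
        ≡⟨ cong ∣_∣ (trans (∑-comm (Y v) (X u) _) (∑-cong (X u) λ t → ∑-cong (Y v) λ s → W≡ t s)) ⟩
      ∣ ∑[ t ∈ X u ] ∑[ s ∈ Y v ] (row t * col s * (G u v t s - c)) ∣
        ≤⟨ rectangleSum-bound (X u) (Y v) row col (λ t s → G u v t s - c) 0≤ε row∈[0,1] col∈[0,1] box≤ ⟩
      ε * (nU * nV)
        ≡⟨ *-assoc ε nU nV ⟨
      ε * nU * nV ∎
      where
      open Rectangular (∏-weight-rectangular u v x y R uv∉R)
      W≡ : ∀ t s → W (x [ u ]≔ t) (y [ v ]≔ s) ≡ row t * col s * (G u v t s - c)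
      W≡ t s = begin-equality
        W (x [ u ]≔ t) (y [ v ]≔ s)
          ≡⟨ cong₂ (λ t′ s′ → (G u v t′ s′ - c) * ∏[ j ∈ R ] weight j (x [ u ]≔ t , y [ v ]≔ s))
                   (lookup∘update u x t) (lookup∘update v y s) ⟩
        (G u v t s - c) * ∏[ j ∈ R ] weight j (x [ u ]≔ t , y [ v ]≔ s)
          ≡⟨ cong ((G u v t s - c) *_) (factorises t s) ⟩
        (G u v t s - c) * (row t * col s)
          ≡⟨ *-comm (G u v t s - c) (row t * col s) ⟩
        row t * col s * (G u v t s - c) ∎

    sliceX≤ : ∀ x → ∣ ∑[ t ∈ X u ] ∑[ y ∈ tuplesOf p Y ] W (x [ u ]≔ t) y ∣ ≤ ε * nY * nU
    sliceX≤ x = begin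
      ∣ ∑[ t ∈ X u ] ∑[ y ∈ tuplesOf p Y ] W (x [ u ]≔ t) y ∣
        ≡⟨ cong ∣_∣ (∑-comm (X u) (tuplesOf p Y) _) ⟩
      ∣ ∑[ y ∈ tuplesOf p Y ] ∑[ t ∈ X u ] W (x [ u ]≔ t) y ∣
        ≤⟨ ∣∑-tuplesOf∣≤-by-slices p Y v (λ y → ∑[ t ∈ X u ] W (x [ u ]≔ t) y) (ε * nU) (sliceXY≤ x) ⟩
      ε * nU * nY
        ≡⟨ solve 3 (λ e a b → e :* a :* b := e :* b :* a) refl ε nU nY ⟩
      ε * nY * nU ∎

  countingLemma : ∀ {ε} → 0ℚ ≤ ε → (c : Fin k → Fin m → ℚ) → (∀ u v → ∣ c u v ∣ ≤ 1ℚ) →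
    (∀ u v → let nU = ℕtoℚ (length (X u)); nV = ℕtoℚ (length (Y v)) in
      boxSum (X u) (Y v) (λ t s → G u v t s - c u v) ≤ ε * ε * ε * ε * ((nU * nU) * (nV * nV))) →
    ∣ totalWeight - ∏[ u ∈ List.allFin k ] ∏[ v ∈ List.allFin m ] c u v * (nX * nY) ∣ ≤ ε * ℕtoℚ k * ℕtoℚ m * (nX * nY)
  countingLemma {ε} 0≤ε c ∣c∣≤1 box≤ = begin
    ∣ totalWeight - ∏[ u ∈ List.allFin k ] ∏[ v ∈ List.allFin m ] c u v * (nX * nY) ∣
      ≡⟨ cong ∣_∣ flatten ⟨
    ∣ ∑[ z ∈ configs ] (∏[ j ∈ indices ] weight j z - ∏ indices c′) ∣
      ≤⟨ telescoping-bound configs weight c′ (λ (u , v) → ∣c∣≤1 u v)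
           (λ (u , v) → deviation-bound 0≤ε u v (c u v) (box≤ u v)) indices indices-unique ⟩
    ℕtoℚ (length indices) * (ε * (nX * nY))
      ≡⟨ cong (_* (ε * (nX * nY))) length-indices ⟩
    ℕtoℚ k * ℕtoℚ m * (ε * (nX * nY))
      ≡⟨ solve 5 (λ a b e x y → a :* b :* (e :* (x :* y)) := e :* a :* b :* (x :* y)) refl (ℕtoℚ k) (ℕtoℚ m) ε nX nY ⟩
    ε * ℕtoℚ k * ℕtoℚ m * (nX * nY) ∎
    where
    open ≤-Reasoning
    c′ : Index → ℚ
    c′ (u , v) = c u v

    indices-unique : Unique indices
    indices-unique = Unique.cartesianProduct⁺ (Unique.allFin⁺ k) (Unique.allFin⁺ m)

    length-indices : ℕtoℚ (length indices) ≡ ℕtoℚ k * ℕtoℚ m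
    length-indices = trans (ℕtoℚ-length-cartesianProduct (List.allFin k) (List.allFin m))
      (cong₂ (λ a b → ℕtoℚ a * ℕtoℚ b) (List.length-tabulate {n = k} id) (List.length-tabulate {n = m} id))

    flatten : ∑[ z ∈ configs ] (∏[ j ∈ indices ] weight j z - ∏ indices c′)
            ≡ totalWeight - ∏[ u ∈ List.allFin k ] ∏[ v ∈ List.allFin m ] c u v * (nX * nY)
    flatten = begin-equality
      ∑[ z ∈ configs ] (∏[ j ∈ indices ] weight j z - ∏ indices c′)
        ≡⟨ ∑-minus-const configs _ (∏ indices c′) ⟩
      ∑[ z ∈ configs ] ∏[ j ∈ indices ] weight j z - ℕtoℚ (length configs) * ∏ indices c′
        ≡⟨ cong₂ _-_ (∑-cartesianProduct (tuplesOf p X) (tuplesOf p Y) _)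
                     (cong₂ _*_ (ℕtoℚ-length-cartesianProduct (tuplesOf p X) (tuplesOf p Y))
                                (∏-cartesianProduct (List.allFin k) (List.allFin m) c′)) ⟩
      ∑[ x ∈ tuplesOf p X ] ∑[ y ∈ tuplesOf p Y ] ∏[ j ∈ indices ] weight j (x , y)
        - (nX * nY) * ∏[ u ∈ List.allFin k ] ∏[ v ∈ List.allFin m ] c u v
        ≡⟨ cong₂ _-_ (∑-cong (tuplesOf p X) λ x → ∑-cong (tuplesOf p Y) λ y →
                        ∏-cartesianProduct (List.allFin k) (List.allFin m) (λ j → weight j (x , y)))
                     (*-comm (nX * nY) _) ⟩
      totalWeight - ∏[ u ∈ List.allFin k ] ∏[ v ∈ List.allFin m ] c u v * (nX * nY) ∎

signed : Bool → ℚ → ℚ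
signed true  q = q
signed false q = - q

boxSum-signed : ∀ (X : List A) (Y : List B) e H → boxSum X Y (λ t s → signed e (H t s)) ≡ boxSum X Y H
boxSum-signed X Y true  H = refl
boxSum-signed X Y false H = boxSum-neg X Y H

indicator-≟-deviation : ∀ a e q →
  indicator (does (a Bool.≟ e)) - (if e then q else 1ℚ - q) ≡ signed e (indicator a - q)
indicator-≟-deviation true  true  q = refl
indicator-≟-deviation false true  q = refl
indicator-≟-deviation true  false q = solve 1 (λ q → con 0ℚ :- (con 1ℚ :- q) := :- (con 1ℚ :- q)) refl q
indicator-≟-deviation false false q = solve 1 (λ q → con 1ℚ :- (con 1ℚ :- q) := :- (con 0ℚ :- q)) refl q

module Agreement (p : ℕ) .{{_ : NonZero p}} {n ℓ : ℕ} (𝓛 : LinearFactor p n ℓ) {k m : ℕ}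
  (E : Fin k → Fin m → Bool) (A : Vp p n → Bool) (dU : Fin k → Vp p ℓ) (dV : Fin m → Vp p ℓ) where

  LU : Fin k → List (Vp p n)
  LU u = L p 𝓛 (dU u)

  LV : Fin m → List (Vp p n)
  LV v = L p 𝓛 (dV v)

  agree : Fin k → Fin m → Vp p n → Vp p n → ℚ
  agree u v t s = indicator (does (A (_+V_ p t s) Bool.≟ E u v))

  expected : Fin k → Fin m → ℚ
  expected u v = if E u v then α p 𝓛 E A dU dV u v else 1ℚ - α p 𝓛 E A dU dV u v

  open CountingLemma p LU LV agree (λ u v t s → indicator∈[0,1] _) public

  α∈[0,1] : ∀ u v → α p 𝓛 E A dU dV u v ∈[0,1]
  α∈[0,1] u v = frac∈[0,1] (List.length-filter _ (L p 𝓛 (_+V_ p (dU u) (dV v))))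

  ∣expected∣≤1 : ∀ u v → ∣ expected u v ∣ ≤ 1ℚ
  ∣expected∣≤1 u v with E u v
  ... | true  = ∈[0,1]⇒∣q∣≤1 (α∈[0,1] u v)
  ... | false = ∈[0,1]⇒∣q∣≤1 (∈[0,1]⇒1-q∈[0,1] (α∈[0,1] u v))

  goodCount≡totalWeight : ℕtoℚ (goodCount p 𝓛 E A dU dV) ≡ totalWeight
  goodCount≡totalWeight = begin
    ℕtoℚ (goodCount p 𝓛 E A dU dV)
      ≡⟨ ℕtoℚ-length-filterᵇ _ (concatMap (λ x → map (x ,_) (tuplesOf p LV)) (tuplesOf p LU)) ⟩
    ∑ (concatMap (λ x → map (x ,_) (tuplesOf p LV)) (tuplesOf p LU)) _
      ≡⟨ ∑-concatMap (λ x → map (x ,_) (tuplesOf p LV)) (tuplesOf p LU) _ ⟩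
    ∑[ x ∈ tuplesOf p LU ] ∑ (map (x ,_) (tuplesOf p LV)) _
      ≡⟨ ∑-cong (tuplesOf p LU) (λ x → trans (∑-map (x ,_) (tuplesOf p LV) _) (∑-cong (tuplesOf p LV) λ y →
           trans (indicator-allᵇ _ (List.allFin k)) (∏-cong (List.allFin k) λ u → indicator-allᵇ _ (List.allFin m)))) ⟩
    totalWeight ∎
    where open ≡-Reasoning

  sizeProduct≡nX*nY : ℕtoℚ (sizeProduct p 𝓛 E A dU dV) ≡ nX * nY
  sizeProduct≡nX*nY = begin
    ℕtoℚ (ℕ.product (map (length ∘ LU) (List.allFin k)) ℕ.* ℕ.product (map (length ∘ LV) (List.allFin m)))
      ≡⟨ ℕtoℚ-* (ℕ.product (map (length ∘ LU) (List.allFin k))) (ℕ.product (map (length ∘ LV) (List.allFin m))) ⟩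
    ℕtoℚ (ℕ.product (map (length ∘ LU) (List.allFin k))) * ℕtoℚ (ℕ.product (map (length ∘ LV) (List.allFin m)))
      ≡⟨ cong₂ (λ a b → ℕtoℚ a * ℕtoℚ b) (length-tuplesOf p LU) (length-tuplesOf p LV) ⟨
    nX * nY ∎
    where open ≡-Reasoning

  mainTerm≡ : mainTerm p 𝓛 E A dU dV ≡ ∏[ u ∈ List.allFin k ] ∏[ v ∈ List.allFin m ] expected u v * (nX * nY)
  mainTerm≡ = cong₂ _*_ (prodℚ-concatMap (λ u → map (expected u) (List.allFin m)) (List.allFin k)) sizeProduct≡nX*nY

  boxSum-agree≤ : ∀ {ε} u v → U2⁴ p 𝓛 (λ z → indicator (A z) - α p 𝓛 E A dU dV u v) (dU u) (dV v) ≤ ε * ε * ε * ε →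
    let nU = ℕtoℚ (length (LU u)); nV = ℕtoℚ (length (LV v)) in
    boxSum (LU u) (LV v) (λ t s → agree u v t s - expected u v) ≤ ε * ε * ε * ε * ((nU * nU) * (nV * nV))
  boxSum-agree≤ {ε} u v U²≤ = begin
    boxSum (LU u) (LV v) (λ t s → agree u v t s - expected u v)
      ≡⟨ boxSum-cong (LU u) (LV v) (λ t s → indicator-≟-deviation (A (_+V_ p t s)) (E u v) (α p 𝓛 E A dU dV u v)) ⟩
    boxSum (LU u) (LV v) (λ t s → signed (E u v) (f (_+V_ p t s)))
      ≡⟨ boxSum-signed (LU u) (LV v) (E u v) (λ t s → f (_+V_ p t s)) ⟩
    boxSum (LU u) (LV v) (λ t s → f (_+V_ p t s))
      ≡⟨ boxSum≡sizes*boxAvg (LU u) (LV v) (λ t s → f (_+V_ p t s)) ⟩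
    N * U2⁴ p 𝓛 f (dU u) (dV v)
      ≤⟨ *-monoˡ-≤-0≤ (0≤* (0≤p*p nU) (0≤p*p nV)) U²≤ ⟩
    N * (ε * ε * ε * ε)
      ≡⟨ *-comm N _ ⟩
    ε * ε * ε * ε * N ∎
    where
    open ≤-Reasoning
    f : Vp p n → ℚ
    f z = indicator (A z) - α p 𝓛 E A dU dV u v
    nU nV N : ℚ
    nU = ℕtoℚ (length (LU u))
    nV = ℕtoℚ (length (LV v))
    N = (nU * nU) * (nV * nV)

propositionD4 :
    (p : ℕ) .{{_ : NonZero p}} → Prime p → 2 ℕ.< p →
    (ε : ℚ) → 0ℚ ℚ.< ε →
    (k m : ℕ) (E : Fin k → Fin m → Bool) →
    (n ℓ : ℕ) (A : Vp p n → Bool) (𝓛 : LinearFactor p n ℓ) →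
    (dU : Fin k → Vp p ℓ) (dV : Fin m → Vp p ℓ) →
    ((u : Fin k) (v : Fin m) →
      U2⁴ p 𝓛 (λ z → indicator (A z) ℚ.- α p 𝓛 E A dU dV u v) (dU u) (dV v)
        ℚ.≤ ε ℚ.* ε ℚ.* ε ℚ.* ε) →
    ℚ.∣ ℕtoℚ (goodCount p 𝓛 E A dU dV) ℚ.- mainTerm p 𝓛 E A dU dV ∣
      ℚ.≤ ε ℚ.* ℕtoℚ k ℚ.* ℕtoℚ m ℚ.* ℕtoℚ (sizeProduct p 𝓛 E A dU dV)
propositionD4 p _ _ ε 0<ε k m E n ℓ A 𝓛 dU dV U²≤ = begin
  ∣ ℕtoℚ (goodCount p 𝓛 E A dU dV) - mainTerm p 𝓛 E A dU dV ∣
    ≡⟨ cong₂ (λ a b → ∣ a - b ∣) goodCount≡totalWeight mainTerm≡ ⟩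
  ∣ totalWeight - ∏[ u ∈ List.allFin k ] ∏[ v ∈ List.allFin m ] expected u v * (nX * nY) ∣
    ≤⟨ countingLemma (<⇒≤ 0<ε) expected ∣expected∣≤1 (λ u v → boxSum-agree≤ {ε} u v (U²≤ u v)) ⟩
  ε * ℕtoℚ k * ℕtoℚ m * (nX * nY)
    ≡⟨ cong (ε * ℕtoℚ k * ℕtoℚ m *_) sizeProduct≡nX*nY ⟨
  ε * ℕtoℚ k * ℕtoℚ m * ℕtoℚ (sizeProduct p 𝓛 E A dU dV) ∎
  where
  open ≤-Reasoning
  open Agreement p 𝓛 E A dU dV
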